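{- Let $\pi$ be an isotone partial probability function on $L^*_n$. Then there exist a partial probability space $(K^n, M[\mathcal{F}^*_n],\mu)$ and a homomorphism $\varphi:\mathcal{F}^*_n\to M[\mathcal{F}^*_n]$ such that $\pi(\alpha)=\mu(\varphi(\alpha))$ for every formula $\alpha$ of $L^*_n$.
   Context: $L^*_n$ is the propositional language with variables $p_1,\dots,p_n$, connectives $\lnot,\wedge,\vee$ and constants $0,1,n$; $F^*_n$ its set of formulas, $\mathcal{F}^*_n$ its absolutely free algebra. $K=\{0,n,1\}$. For a set $S$, $\mathcal{D}(S)$ is the algebra of partial sets $\{(A,B):A,B\subseteq S,A\cap B=\emptyset\}$ with $(A,B)\sqcap(C,D)=(A\cap C,B\cup D)$, $(A,B)\sqcup(C,D)=(A\cup C,B\cap D)$, $-(A,B)=(B,A)$, $0=(\emptyset,S)$, $1=(S,\emptyset)$, $n=(\emptyset,\emptyset)$, and $(A,B)\sqsubseteq(C,D)$ iff $A\subseteq C$ and $D\subseteq B$. The meaning $M:\mathcal{F}^*_n\to\mathcal{D}(K^n)$ is the homomorphism with $M(p_i)=(\{s:s_i=1\},\{s:s_i=0\})$; $M[\mathcal{F}^*_n]$ is its image (a subalgebra). Kleene consequence: $\alpha\models\beta$ iff $M(\alpha)\sqsubseteq M(\beta)$. Let $T=\{(x,y)\in[0,1]^2:x+y\le1\}$, $(x,y)\preccurlyeq(w,z)$ iff $x\le w$ and $z\le y$, pair arithmetic componentwise, $\sigma(x,y)=(y,x)$. A partial probability function on $L^*_n$ is $\pi:F^*_n\to T$ with: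 $1\models\alpha\Rightarrow\pi(\alpha)=(1,0)$; $\pi(\alpha\vee\beta)=\pi(\alpha)+\pi(\beta)-\pi(\alpha\wedge\beta)$; $\pi(\lnot\alpha)=\sigma(\pi(\alpha))$; $n\models\alpha\Rightarrow(0,0)\preccurlyeq\pi(\alpha)$. It is isotone if $\alpha\models\beta$ implies $\pi(\alpha)\preccurlyeq\pi(\beta)$. A partial probability space $(S,\mathcal{G}_S,\mu)$ is a subalgebra $\mathcal{G}_S$ of $\mathcal{D}(S)$ with $\mu:G_S\to T$ such that $\mu(S,\emptyset)=(1,0)$, $\mu(x\sqcup y)=\mu(x)+\mu(y)-\mu(x\sqcap y)$, $\mu(-x)=\sigma(\mu(x))$, and $(0,0)\preccurlyeq\mu(A,\emptyset)$ whenever $(A,\emptyset)\in G_S$. -}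

module Defs where

open import Level using (0ℓ)
open import Data.Nat using (ℕ; zero; suc)
open import Data.Fin using (Fin)
open import Data.Bool using (Bool; true; false; _∧_; _∨_; T)
open import Data.Vec using (Vec; []; _∷_; lookup)
open import Data.Product using (Σ; ∃; _×_; _,_; proj₁; proj₂)
open import Data.Empty using (⊥)
open import Relation.Nullary using (¬_)
open import Relation.Binary.PropositionalEquality using (_≡_)
open import Algebra.Structures using (IsCommutativeRing)
open import Relation.Binary.Structures using (IsTotalOrder)

-- The real numbers, axiomatised as a complete ordered field
-- (with propositional equality).  Theorems are stated for every such
-- structure (all of which are isomorphic to ℝ).

record Reals : Set₁ where
  infixl 6 _+_
  infixl 7 _*_
  infix 4 _≤_
  infix 8 -_
  field
    Carrier : Set
    0r 1r   : Carrier
    _+_ _*_ : Carrier → Carrier → Carrier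
    -_      : Carrier → Carrier
    _≤_     : Carrier → Carrier → Set
    isCommutativeRing : IsCommutativeRing _≡_ _+_ _*_ -_ 0r 1r
    isTotalOrder      : IsTotalOrder _≡_ _≤_
    +-mono-≤  : ∀ {x y} z → x ≤ y → x + z ≤ y + z
    *-nonneg  : ∀ {x y} → 0r ≤ x → 0r ≤ y → 0r ≤ x * y
    0≢1       : ¬ (0r ≡ 1r)
    inverse   : ∀ x → ¬ (x ≡ 0r) → ∃ λ y → x * y ≡ 1r
    complete  : (P : Carrier → Set) → (∃ λ x → P x) →
                (∃ λ b → ∀ x → P x → x ≤ b) →
                ∃ λ s → (∀ x → P x → x ≤ s) ×
                        (∀ b → (∀ x → P x → x ≤ b) → s ≤ b)

infixr 6 _and_
infixr 5 _or_

data Form (n : ℕ) : Set where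
  var  : Fin n → Form n
  neg  : Form n → Form n
  _and_ : Form n → Form n → Form n
  _or_  : Form n → Form n → Form n
  c0 c1 cn : Form n

data K : Set where
  k0 kn k1 : K

-- Subsets of K^n (points of K^n are Vec K n), represented as a
-- ternary tree of booleans so that ≡ is extensional equality of sets.

KSet : ℕ → Set
KSet zero    = Bool
KSet (suc n) = KSet n × KSet n × KSet n

_∈_ : ∀ {n} → Vec K n → KSet n → Set
[]        ∈ b              = T b
(k0 ∷ s)  ∈ (a , _ , _)    = s ∈ a
(kn ∷ s)  ∈ (_ , b , _)    = s ∈ b
(k1 ∷ s)  ∈ (_ , _ , c)    = s ∈ c

tab : ∀ {n} → (Vec K n → Bool) → KSet n
tab {zero}  f = f []
tab {suc n} f = tab (λ s → f (k0 ∷ s)) , tab (λ s → f (kn ∷ s)) , tab (λ s → f (k1 ∷ s))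

_∪_ : ∀ {n} → KSet n → KSet n → KSet n
_∪_ {zero}  a b = a ∨ b
_∪_ {suc n} (a , b , c) (a' , b' , c') = (a ∪ a') , (b ∪ b') , (c ∪ c')

_∩_ : ∀ {n} → KSet n → KSet n → KSet n
_∩_ {zero}  a b = a ∧ b
_∩_ {suc n} (a , b , c) (a' , b' , c') = (a ∩ a') , (b ∩ b') , (c ∩ c')

full empty : ∀ {n} → KSet n
full  = tab (λ _ → true)
empty = tab (λ _ → false)

_⊆_ : ∀ {n} → KSet n → KSet n → Set
A ⊆ B = ∀ s → s ∈ A → s ∈ B

-- The algebra D(K^n) of partial sets: pairs (A , B); the elements
-- relevant here (the image of M) are disjoint pairs.

PS : ℕ → Set
PS n = KSet n × KSet n

_⊓_ : ∀ {n} → PS n → PS n → PS n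
(A , B) ⊓ (C , D) = (A ∩ C) , (B ∪ D)

_⊔_ : ∀ {n} → PS n → PS n → PS n
(A , B) ⊔ (C , D) = (A ∪ C) , (B ∩ D)

compl : ∀ {n} → PS n → PS n
compl (A , B) = B , A

pzero pone pn : ∀ {n} → PS n
pzero = empty , full
pone  = full , empty
pn    = empty , empty

_⊑_ : ∀ {n} → PS n → PS n → Set
(A , B) ⊑ (C , D) = (A ⊆ C) × (D ⊆ B)

isK : K → K → Bool
isK k0 k0 = true
isK kn kn = true
isK k1 k1 = true
isK _  _  = false

M : ∀ {n} → Form n → PS n
M (var i)   = tab (λ s → isK (lookup s i) k1) , tab (λ s → isK (lookup s i) k0)
M (neg α)   = compl (M α)
M (α and β) = M α ⊓ M β
M (α or β)  = M α ⊔ M β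
M c0 = pzero
M c1 = pone
M cn = pn

InImage : ∀ {n} → PS n → Set
InImage {n} x = Σ (Form n) λ α → M α ≡ x

_⊨_ : ∀ {n} → Form n → Form n → Set
α ⊨ β = M α ⊑ M β

module Prob (ℝ : Reals) where
  open Reals ℝ

  R² : Set
  R² = Carrier × Carrier

  InT : R² → Set
  InT (x , y) = (0r ≤ x) × (x ≤ 1r) × (0r ≤ y) × (y ≤ 1r) × (x + y ≤ 1r)

  _⊕_ : R² → R² → R²
  (x , y) ⊕ (w , z) = (x + w) , (y + z)

  _⊖_ : R² → R² → R²
  (x , y) ⊖ (w , z) = (x + - w) , (y + - z)

  σ : R² → R²
  σ (x , y) = y , x

  infix 4 _≼_
  infixl 6 _⊕_ _⊖_
  _≼_ : R² → R² → Set
  (x , y) ≼ (w , z) = (x ≤ w) × (z ≤ y)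

  record IsPartialProbability {n : ℕ} (π : Form n → R²) : Set where
    field
      inT     : ∀ α → InT (π α)
      tautol  : ∀ α → c1 ⊨ α → π α ≡ (1r , 0r)
      or-law  : ∀ α β → π (α or β) ≡ (π α ⊕ π β) ⊖ π (α and β)
      neg-law : ∀ α → π (neg α) ≡ σ (π α)
      n-law   : ∀ α → cn ⊨ α → (0r , 0r) ≼ π α

  Isotone : ∀ {n} → (Form n → R²) → Set
  Isotone π = ∀ α β → α ⊨ β → π α ≼ π β

  -- (K^n, M[F*_n], μ) is a partial probability space.  μ is a function
  -- on the subtype M[F*_n] (argument: element plus membership proof),
  -- required not to depend on the membership proof.
  record IsPartialProbSpaceOnImage {n : ℕ}
         (μ : (x : PS n) → InImage x → R²) : Set where
    field
      irrel    : ∀ x (p q : InImage x) → μ x p ≡ μ x q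
      inT      : ∀ x (p : InImage x) → InT (μ x p)
      unit     : ∀ (p : InImage (full , empty)) → μ (full , empty) p ≡ (1r , 0r)
      join-law : ∀ x y (p : InImage x) (q : InImage y)
                   (r : InImage (x ⊔ y)) (s : InImage (x ⊓ y)) →
                   μ (x ⊔ y) r ≡ (μ x p ⊕ μ y q) ⊖ μ (x ⊓ y) s
      compl-law : ∀ x (p : InImage x) (q : InImage (compl x)) →
                   μ (compl x) q ≡ σ (μ x p)
      n-law    : ∀ A (p : InImage (A , empty)) → (0r , 0r) ≼ μ (A , empty) p

  -- φ : F*_n → M[F*_n] is a homomorphism (the codomain being the
  -- subalgebra M[F*_n] of D(K^n)).
  record IsHomToImage {n : ℕ} (φ : Form n → PS n) : Set where
    field
      inImage : ∀ α → InImage (φ α)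
      hom-neg : ∀ α → φ (neg α) ≡ compl (φ α)
      hom-and : ∀ α β → φ (α and β) ≡ φ α ⊓ φ β
      hom-or  : ∀ α β → φ (α or β) ≡ φ α ⊔ φ β
      hom-0   : φ c0 ≡ pzero
      hom-1   : φ c1 ≡ pone
      hom-n   : φ cn ≡ pn

module Submission where

-- An isotone partial probability function π only depends on
-- the meaning of a formula: if M α ≡ M β then α ⊨ β and β ⊨ α, so isotony
-- and antisymmetry of ≼ give π α ≡ π β.  Hence π descends to the image
-- M[F*_n]: the measure μ of an element x = M α is π α, and this is
-- independent of the chosen preimage α.  The homomorphism φ is M itself,
-- which preserves every operation by definition, so π α ≡ μ (M α) holds
-- by construction.  The axioms of a partial probability space for μ are
-- then the axioms of π transported along the equalities M γ ≡ M α ⊔ M β,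
-- M δ ≡ M α ⊓ M β, etc.

open import Defs
open import Data.Nat using (ℕ)
open import Data.Product using (Σ; _,_)
open import Data.Bool using (Bool; false; T)
open import Data.Vec using (Vec; []; _∷_)
open import Data.Empty using (⊥-elim)
open import Relation.Nullary using (¬_)
open import Relation.Binary.PropositionalEquality
  using (_≡_; refl; sym; trans; cong; cong₂; subst; module ≡-Reasoning)
open import Relation.Binary.Structures using (IsTotalOrder)

≡⇒⊑ : ∀ {n} {x y : PS n} → x ≡ y → x ⊑ y
≡⇒⊑ refl = (λ _ s∈ → s∈) , (λ _ s∈ → s∈)

∈tab⇒T : ∀ {n} (f : Vec K n → Bool) (s : Vec K n) → s ∈ tab f → T (f s)
∈tab⇒T f []       s∈ = s∈
∈tab⇒T f (k0 ∷ s) s∈ = ∈tab⇒T (λ t → f (k0 ∷ t)) s s∈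
∈tab⇒T f (kn ∷ s) s∈ = ∈tab⇒T (λ t → f (kn ∷ t)) s s∈
∈tab⇒T f (k1 ∷ s) s∈ = ∈tab⇒T (λ t → f (k1 ∷ t)) s s∈

∉empty : ∀ {n} (s : Vec K n) → ¬ (s ∈ empty)
∉empty = ∈tab⇒T (λ _ → false)

-- The constant n = (∅ , ∅) lies below every partial set of the form (A , ∅);
-- this turns the n-law of π into the n-law of μ.
pn⊑ : ∀ {n} (A : KSet n) → pn ⊑ (A , empty)
pn⊑ A = (λ s s∈ → ⊥-elim (∉empty s s∈)) , (λ _ s∈ → s∈)

meaningHom : (ℝ : Reals) → ∀ {n} → Prob.IsHomToImage ℝ (M {n})
meaningHom ℝ = record
  { inImage = λ α → α , refl
  ; hom-neg = λ _ → refl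
  ; hom-and = λ _ _ → refl
  ; hom-or  = λ _ _ → refl
  ; hom-0   = refl
  ; hom-1   = refl
  ; hom-n   = refl
  }

module Induced (ℝ : Reals) {n : ℕ} (π : Form n → Prob.R² ℝ)
               (pp : Prob.IsPartialProbability ℝ π) (iso : Prob.Isotone ℝ π) where
  open Reals ℝ
  open Prob ℝ
  open IsPartialProbability pp

  ≼-antisym : ∀ {a b : R²} → a ≼ b → b ≼ a → a ≡ b
  ≼-antisym (x≤w , z≤y) (w≤x , y≤z) =
    cong₂ _,_ (antisym x≤w w≤x) (antisym y≤z z≤y)
    where open IsTotalOrder isTotalOrder using (antisym)

  respectsMeaning : ∀ α β → M α ≡ M β → π α ≡ π β
  respectsMeaning α β e = ≼-antisym (iso α β (≡⇒⊑ e)) (iso β α (≡⇒⊑ (sym e)))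

  μ : (x : PS n) → InImage x → R²
  μ _ (α , _) = π α

  space : IsPartialProbSpaceOnImage μ
  space = record
    { irrel     = λ { _ (α , eα) (β , eβ) → respectsMeaning α β (trans eα (sym eβ)) }
    ; inT       = λ { _ (α , _) → inT α }
    ; unit      = λ { (α , eα) → tautol α (≡⇒⊑ (sym eα)) }
    ; join-law  = join-law
    ; compl-law = compl-law
    ; n-law     = λ { A (α , eα) → n-law α (subst (pn ⊑_) (sym eα) (pn⊑ A)) }
    }
    where
    join-law : ∀ x y (p : InImage x) (q : InImage y)
               (r : InImage (x ⊔ y)) (s : InImage (x ⊓ y)) →
               μ (x ⊔ y) r ≡ (μ x p ⊕ μ y q) ⊖ μ (x ⊓ y) s
    join-law _ _ (α , eα) (β , eβ) (γ , eγ) (δ , eδ) = begin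
      π γ                           ≡⟨ respectsMeaning γ (α or β) (trans eγ (sym (cong₂ _⊔_ eα eβ))) ⟩
      π (α or β)                    ≡⟨ or-law α β ⟩
      (π α ⊕ π β) ⊖ π (α and β)     ≡⟨ cong ((π α ⊕ π β) ⊖_) (respectsMeaning (α and β) δ (trans (cong₂ _⊓_ eα eβ) (sym eδ))) ⟩
      (π α ⊕ π β) ⊖ π δ             ∎
      where open ≡-Reasoning

    compl-law : ∀ x (p : InImage x) (q : InImage (compl x)) →
                μ (compl x) q ≡ σ (μ x p)
    compl-law _ (α , eα) (β , eβ) =
      trans (respectsMeaning β (neg α) (trans eβ (sym (cong compl eα)))) (neg-law α)

mainTheorem17 : (ℝ : Reals) → let open Prob ℝ in
    (n : ℕ) (π : Form n → R²) →
    IsPartialProbability π → Isotone π →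
    Σ ((x : PS n) → InImage x → R²) λ μ →
    Σ (Form n → PS n) λ φ →
    Σ (IsPartialProbSpaceOnImage μ) λ _ →
    Σ (IsHomToImage φ) λ h →
      ∀ α → π α ≡ μ (φ α) (IsHomToImage.inImage h α)
mainTheorem17 ℝ n π pp iso = μ , M , space , meaningHom ℝ , λ _ → refl
  where open Induced ℝ π pp iso
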